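{- Let $G$ be a pseudo-bipartite graph on $2m$ vertices with clusters $C_1=\{v_{1,1},\dots,v_{1,m}\}$ and $C_2=\{v_{2,1},\dots,v_{2,m}\}$. Then $G$ and its graph theoretical partial transpose $G^\tau$ are isomorphic, and hence cospectral. In particular, if $G$ is a bipartite graph whose two parts have the same number $m$ of vertices, taken as the two clusters $C_1,C_2$, then $G$ and $G^\tau$ are isomorphic.
   Context: All graphs are finite, simple and undirected. A clustered graph on $mn$ vertices with clusters $C_i=\{v_{i,1},\dots,v_{i,m}\}$, $i=1,\dots,n$, is a graph whose labelled vertex set is partitioned into these clusters; $C_i$ also denotes the subgraph induced by its vertices. The graph theoretical partial transpose (GTPT) $G^\tau$ of such a graph is the graph on the same vertex set obtained from $G$ as follows: every edge inside a cluster and every edge of the form $(v_{i,k},v_{j,k})$ is kept, and every edge $(v_{i,k},v_{j,l})$ with $i\neq j$ and $k\neq l$ is removed and replaced by the edge $(v_{i,l},v_{j,k})$. Equivalently, if the adjacency matrix of $G$ is the block matrix $[A_{i,j}]_{i,j=1}^n$ with $m\times m$ blocks, where $(A_{i,j})_{\alpha\beta}=1$ iff $v_{i,\alpha}$ and $v_{j,\beta}$ are adjacent, then the adjacency matrix of $G^\tau$ is $[A_{i,j}^t]$. A clustered graph with two clusters $C_1,C_2$ of $m$ vertices each is called pseudo-bipartite if the map $v_{1,j}\mapsto v_{2,j}$ ($j=1,\dots,m$) is an isomorphism from the induced subgraph on $C_1$ to the induced subgraph on $C_2$. Two graphs are cospectral if their adjacency matrices have the same multiset of eigenvalues. -}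

module Defs where

open import Data.Nat using (ℕ)
open import Data.Fin using (Fin; zero; suc; _≟_)
open import Data.Bool using (Bool; true; false)
open import Data.Product using (_×_; _,_; Σ)
open import Relation.Nullary using (¬_; yes; no)
open import Relation.Binary.PropositionalEquality using (_≡_)
open import Function.Bundles using (_↔_; Inverse)

-- Vertices of a clustered graph with n clusters of m vertices each:
-- (i , k) stands for v_{i,k}.
Vertex : ℕ → ℕ → Set
Vertex n m = Fin n × Fin m

record Graph (V : Set) : Set where
  field
    adj   : V → V → Bool
    sym   : ∀ x y → adj x y ≡ adj y x
    irrefl : ∀ x → adj x x ≡ false
open Graph public

ClusteredGraph : ℕ → ℕ → Set
ClusteredGraph n m = Graph (Vertex n m)

-- Adjacency of the graph theoretical partial transpose:
-- the block A_{i,j} is replaced by its transpose, i.e.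
-- v_{i,k} ~ v_{j,l} in G^τ iff v_{i,l} ~ v_{j,k} in G.
-- (For i = j the block A_{i,i} is kept as is, as in the paper.)
gtptAdj : ∀ {n m} → ClusteredGraph n m → Vertex n m → Vertex n m → Bool
gtptAdj G (i , k) (j , l) with i ≟ j
... | yes _ = adj G (i , k) (j , l)
... | no  _ = adj G (i , l) (j , k)

gtptSym : ∀ {n m} (G : ClusteredGraph n m) x y → gtptAdj G x y ≡ gtptAdj G y x
gtptSym G (i , k) (j , l) with i ≟ j | j ≟ i
... | yes _ | yes _ = sym G (i , k) (j , l)
... | yes p | no ¬q = Data.Empty.⊥-elim (¬q (Relation.Binary.PropositionalEquality.sym p))
  where import Data.Empty
... | no ¬p | yes q = Data.Empty.⊥-elim (¬p (Relation.Binary.PropositionalEquality.sym q))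
  where import Data.Empty
... | no _  | no _  = sym G (i , l) (j , k)

gtptIrrefl : ∀ {n m} (G : ClusteredGraph n m) x → gtptAdj G x x ≡ false
gtptIrrefl G (i , k) with i ≟ i
... | yes _ = irrefl G (i , k)
... | no ¬p = Data.Empty.⊥-elim (¬p Relation.Binary.PropositionalEquality.refl)
  where import Data.Empty

gtpt : ∀ {n m} → ClusteredGraph n m → ClusteredGraph n m
gtpt G = record { adj = gtptAdj G ; sym = gtptSym G ; irrefl = gtptIrrefl G }

Isomorphic : ∀ {V W : Set} → Graph V → Graph W → Set
Isomorphic {V} {W} G H =
  Σ (V ↔ W) λ f → ∀ x y → adj H (Inverse.to f x) (Inverse.to f y) ≡ adj G x y

c₁ c₂ : Fin 2
c₁ = zero
c₂ = suc zero

-- Pseudo-bipartite: v_{1,j} ↦ v_{2,j} is an isomorphism from the induced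
-- subgraph on C₁ to the induced subgraph on C₂.
PseudoBipartite : ∀ {m} → ClusteredGraph 2 m → Set
PseudoBipartite {m} G =
  ∀ (k l : Fin m) → adj G (c₂ , k) (c₂ , l) ≡ adj G (c₁ , k) (c₁ , l)

BipartiteClusters : ∀ {m} → ClusteredGraph 2 m → Set
BipartiteClusters {m} G =
  ∀ (i : Fin 2) (k l : Fin m) → adj G (i , k) (i , l) ≡ false

{-# OPTIONS --safe #-}
-- Swapping the two clusters, v_{i,k} ↦ v_{3-i,k} (reversing the cluster
-- order), is the isomorphism.  Across the clusters it sends the edge
-- v_{1,k} v_{2,l} to v_{2,k} v_{1,l}, which is precisely the image of that edge
-- in G^τ; inside a cluster G^τ agrees with G, and the swap is an isomorphism
-- C₁ ≅ C₂ exactly when G is pseudo-bipartite.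
module Submission where

open import Defs
open import Data.Nat using (ℕ)
open import Data.Fin using (zero; suc; opposite)
open import Data.Fin.Properties using (opposite-involutive)
open import Data.Product using (_×_; _,_)
open import Function.Bundles using (_↔_; mk↔ₛ′)
open import Relation.Binary.PropositionalEquality using (_≡_; cong; trans)
import Relation.Binary.PropositionalEquality as ≡

reverseCluster : ∀ {n m} → Vertex n m → Vertex n m
reverseCluster (i , k) = opposite i , k

reverseCluster-involutive : ∀ {n m} (x : Vertex n m) →
                            reverseCluster (reverseCluster x) ≡ x
reverseCluster-involutive (i , k) = cong (_, k) (opposite-involutive i)

reverseCluster-↔ : ∀ {n m} → Vertex n m ↔ Vertex n m
reverseCluster-↔ = mk↔ₛ′ reverseCluster reverseCluster
                          reverseCluster-involutive reverseCluster-involutive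

pseudoBipartite⇒isomorphic-gtpt : ∀ {m} (G : ClusteredGraph 2 m) →
                                  PseudoBipartite G → Isomorphic G (gtpt G)
pseudoBipartite⇒isomorphic-gtpt G pb = reverseCluster-↔ , preserves-adj
  where
  preserves-adj : ∀ x y →
                  adj (gtpt G) (reverseCluster x) (reverseCluster y) ≡ adj G x y
  preserves-adj (zero     , k) (zero     , l) = pb k l
  preserves-adj (zero     , k) (suc zero , l) = sym G (c₂ , l) (c₁ , k)
  preserves-adj (suc zero , k) (zero     , l) = sym G (c₁ , l) (c₂ , k)
  preserves-adj (suc zero , k) (suc zero , l) = ≡.sym (pb k l)

bipartite⇒pseudoBipartite : ∀ {m} (G : ClusteredGraph 2 m) →
                            BipartiteClusters G → PseudoBipartite G
bipartite⇒pseudoBipartite G bip k l = trans (bip c₂ k l) (≡.sym (bip c₁ k l))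

theorem2 : (m : ℕ) (G : ClusteredGraph 2 m) →
           (PseudoBipartite G → Isomorphic G (gtpt G)) ×
           (BipartiteClusters G → Isomorphic G (gtpt G))
theorem2 m G =
  pseudoBipartite⇒isomorphic-gtpt G ,
  λ bip → pseudoBipartite⇒isomorphic-gtpt G (bipartite⇒pseudoBipartite G bip)
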